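{- For $n\ge1$ and $r\ge 0$, the number of simple two-dimensional lattice paths of length $n$ with reduction degree $r$ equals \[ 4^{r+1} \sum_{\lambda \geq 0} \lambda (-1)^{\lambda - 1} \bigg[\binom{2n-1}{n - \lambda 2^{r}} - \binom{2n-1}{n - \lambda 2^{r} - 1}\bigg], \] where binomial coefficients with negative lower index are $0$.
   Context: A simple two-dimensional lattice path of length $n\ge1$ is a word of length $n$ over the steps $\{\uparrow,\rightarrow,\downarrow,\leftarrow\}$; $\rightarrow,\leftarrow$ are horizontal and $\uparrow,\downarrow$ vertical. The reduction $\Phi_L$ is defined on paths of length $\ge2$ as follows: (1) if the path starts with a vertical step, rotate the whole path by $90^\circ$ clockwise (so it starts horizontally); (2) if the resulting path ends with a horizontal step, rotate that last step by $90^\circ$ clockwise. The path now decomposes uniquely into segments, each a nonempty run of horizontal steps followed by a nonempty run of vertical steps. (3) Replace each segment by one diagonal step: $\nearrow$ if it starts with $\rightarrow$ and its first vertical step is $\uparrow$; $\searrow$ if $\rightarrow$ and $\downarrow$; $\swarrow$ if $\leftarrow$ and $\downarrow$; $\nwarrow$ if $\leftarrow$ and $\uparrow$. (4) Rotate by $45^\circ$ clockwise: $\nearrow\mapsto\rightarrow$, $\searrow\mapsto\downarrow$, $\swarrow\mapsto\leftarrow$, $\nwarrow\mapsto\uparrow$. The result is $\Phi_L(\ell)$; $\Phi_L$ is undefined on single steps. The reduction degree $\mathrm{rdeg}(\ell)$ of a path $\ell$ is the unique $m\ge0$ with $\Phi_L^m(\ell)$ a single step. -}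

module Defs where

open import Data.Nat using (ℕ; zero; suc; _+_; _*_; _^_; _∸_)
open import Data.Nat.Combinatorics using (_C_)
open import Data.Integer as ℤ using (ℤ; +_; -[1+_])
open import Data.List using (List; []; _∷_; map; concatMap; length; filter; upTo; reverse)
open import Data.Maybe using (Maybe; just; nothing)
open import Data.Product using (∃; _,_)
open import Relation.Binary.PropositionalEquality using (_≡_; refl)
open import Relation.Nullary using (Dec; yes; no)

data Step : Set where
  U R D L : Step

steps : List Step
steps = U ∷ R ∷ D ∷ L ∷ []

Path : Set
Path = List Step

rot : Step → Step
rot U = R
rot R = D
rot D = L
rot L = U

normStart : Path → Path
normStart []        = []
normStart (U ∷ xs)  = map rot (U ∷ xs)
normStart (D ∷ xs)  = map rot (D ∷ xs)
normStart (R ∷ xs)  = R ∷ xs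
normStart (L ∷ xs)  = L ∷ xs

normEnd : Path → Path
normEnd []           = []
normEnd (x ∷ [])     with x
... | R = D ∷ []
... | L = U ∷ []
... | U = U ∷ []
... | D = D ∷ []
normEnd (x ∷ y ∷ xs) = x ∷ normEnd (y ∷ xs)

-- steps (3)+(4): a segment whose first horizontal step is h and whose first
-- vertical step is v becomes one diagonal step, rotated by 45° clockwise:
-- ↗ ↦ →, ↘ ↦ ↓, ↙ ↦ ←, ↖ ↦ ↑.
diag : Step → Step → Step
diag R U = R
diag R D = D
diag L D = L
diag L U = U
diag h v = h   -- not reached on normalised paths

-- decomposition into segments (run of horizontal steps, then run of vertical
-- steps), each replaced by its reduced step.
mutual
  skipH : Step → Path → Path
  skipH h []       = []
  skipH h (R ∷ xs) = skipH h xs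
  skipH h (L ∷ xs) = skipH h xs
  skipH h (U ∷ xs) = diag h U ∷ skipV xs
  skipH h (D ∷ xs) = diag h D ∷ skipV xs

  -- inside the vertical run of a segment (already emitted)
  skipV : Path → Path
  skipV []       = []
  skipV (U ∷ xs) = skipV xs
  skipV (D ∷ xs) = skipV xs
  skipV (R ∷ xs) = skipH R xs
  skipV (L ∷ xs) = skipH L xs

segments : Path → Path
segments []       = []
segments (h ∷ xs) = skipH h xs

ΦL : Path → Maybe Path
ΦL []           = nothing
ΦL (x ∷ [])     = nothing
ΦL (x ∷ y ∷ xs) = just (segments (normEnd (normStart (x ∷ y ∷ xs))))

iterΦL : ℕ → Path → Maybe Path
iterΦL zero    ℓ = just ℓ
iterΦL (suc m) ℓ with ΦL ℓ
... | nothing = nothing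
... | just ℓ′ = iterΦL m ℓ′

HasRdeg : ℕ → Path → Set
HasRdeg r ℓ = ∃ λ s → iterΦL r ℓ ≡ just (s ∷ [])

isSingle? : (m : Maybe Path) → Dec (∃ λ s → m ≡ just (s ∷ []))
isSingle? nothing             = no λ { (_ , ()) }
isSingle? (just [])           = no λ { (_ , ()) }
isSingle? (just (s ∷ []))     = yes (s , refl)
isSingle? (just (s ∷ t ∷ xs)) = no λ { (_ , ()) }

hasRdeg? : (r : ℕ) (ℓ : Path) → Dec (HasRdeg r ℓ)
hasRdeg? r ℓ = isSingle? (iterΦL r ℓ)

allPaths : ℕ → List Path
allPaths zero    = [] ∷ []
allPaths (suc n) = concatMap (λ p → map (_∷ p) steps) (allPaths n)

countRdeg : ℕ → ℕ → ℕ
countRdeg n r = length (filter (hasRdeg? r) (allPaths n))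

-- binomial coefficient with an integer lower index; 0 for negative index
-- (and, as usual, 0 when the lower index exceeds the upper one)
binomℤ : ℕ → ℤ → ℕ
binomℤ m (+ k)     = m C k
binomℤ m -[1+ k ]  = 0

sumTo : ℕ → (ℕ → ℤ) → ℤ
sumTo zero    f = f 0
sumTo (suc N) f = sumTo N f ℤ.+ f (suc N)

-- (-1)^(λ-1) for λ ≥ 1 (the λ = 0 term is killed by the factor λ anyway)
sgn : ℕ → ℤ
sgn zero    = + 1
sgn (suc k) = (ℤ.- (+ 1)) ℤ.^ k

summand : ℕ → ℕ → ℕ → ℤ
summand n r λ' =
  (+ λ') ℤ.* sgn λ' ℤ.*
    ((+ binomℤ (2 * n ∸ 1) (+ n ℤ.- + (λ' * 2 ^ r)))
      ℤ.- (+ binomℤ (2 * n ∸ 1) (+ n ℤ.- + (λ' * 2 ^ r) ℤ.- + 1)))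

-- Let c(n, r) be the number of paths of length n and degree r.  The first reduction step
-- only sees the decomposition into segments: after the first step, a tail either extends
-- the current horizontal or vertical run (two choices of direction) or closes a segment and
-- emits one reduced step.  Summing over tails of each length this gives a linear recursion,
-- so that c(k + 2, r + 1) = 2 H_k(c(·, r)) for explicit linear operators H_k (hTransfer).
-- The differences D_n(i) = C(2n-1, n-i) - C(2n-1, n-i-1) satisfy, by Pascal's rule twice,
-- D_{n+1}(i+1) = D_n(i) + 2 D_n(i+1) + D_n(i+2), and hence H_k(D_·(j)) = 2 D_{k+2}(2j).
-- Since the claimed formula reads c(n, r) = 4^{r+1} Σ_λ λ(-1)^{λ-1} D_n(λ 2^r), it passes
-- from r to r + 1; for r = 0 the same recurrence makes the alternating sum telescope.

module Submission where

open import Data.Nat as ℕ using (ℕ; zero; suc; _≤_; _<_; _^_; z≤n; s≤s)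
import Data.Nat.Properties as ℕ
open import Data.Nat.Combinatorics using (_C_; nCk≡nC[n∸k]; nCk+nC[k+1]≡[n+1]C[k+1])
open import Data.Integer as ℤ using (ℤ; +_; -[1+_]; _+_; _*_; _-_; -_)
import Data.Integer.Properties as ℤ
open import Algebra.Properties.CommutativeSemigroup ℤ.*-commutativeSemigroup using (x∙yz≈y∙xz)
open import Data.Integer.Tactic.RingSolver using (solve-∀)
open import Data.List using (List; []; _∷_; _++_; map; concatMap; filter; length)
open import Relation.Binary.PropositionalEquality
open import Relation.Nullary using (Dec; yes; no)
open import Relation.Unary using (Pred; Decidable)

open import Defs

open ≡-Reasoning

sumSteps : (Step → ℤ) → ℤ
sumSteps f = f U + f R + f D + f L

_⁺ : (Path → ℤ) → Path → ℤ
(g ⁺) p = sumSteps λ s → g (s ∷ p)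

sumPaths : (Path → ℤ) → ℕ → ℤ
sumPaths g zero    = g []
sumPaths g (suc n) = sumPaths (g ⁺) n

sumSteps-cong : ∀ {f f′ : Step → ℤ} → (∀ s → f s ≡ f′ s) → sumSteps f ≡ sumSteps f′
sumSteps-cong eq = cong₂ _+_ (cong₂ _+_ (cong₂ _+_ (eq U) (eq R)) (eq D)) (eq L)

sumSteps-+ : ∀ (f f′ : Step → ℤ) → sumSteps (λ s → f s + f′ s) ≡ sumSteps f + sumSteps f′
sumSteps-+ f f′ = regroup (f U) (f R) (f D) (f L) (f′ U) (f′ R) (f′ D) (f′ L)
  where
  regroup : ∀ a b c d a′ b′ c′ d′ →
    (a + a′) + (b + b′) + (c + c′) + (d + d′) ≡ (a + b + c + d) + (a′ + b′ + c′ + d′)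
  regroup = solve-∀

sumSteps-*ˡ : ∀ c (f : Step → ℤ) → sumSteps (λ s → c * f s) ≡ c * sumSteps f
sumSteps-*ˡ c f = distrib c (f U) (f R) (f D) (f L)
  where
  distrib : ∀ c a b d e → c * a + c * b + c * d + c * e ≡ c * (a + b + d + e)
  distrib = solve-∀

sumSteps-rot : ∀ (f : Step → ℤ) → sumSteps (λ s → f (rot s)) ≡ sumSteps f
sumSteps-rot f = rotate (f U) (f R) (f D) (f L)
  where
  rotate : ∀ u r d l → r + d + l + u ≡ u + r + d + l
  rotate = solve-∀

sumPaths-cong : ∀ n {g h : Path → ℤ} → (∀ p → g p ≡ h p) → sumPaths g n ≡ sumPaths h n
sumPaths-cong zero    eq = eq []
sumPaths-cong (suc n) eq = sumPaths-cong n λ p → sumSteps-cong λ s → eq (s ∷ p)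

sumPaths-cong⁺ : ∀ n (g h : Path → ℤ) → (∀ s p → g (s ∷ p) ≡ h (s ∷ p)) →
                 sumPaths g (suc n) ≡ sumPaths h (suc n)
sumPaths-cong⁺ n g h eq = sumPaths-cong n λ p → sumSteps-cong λ s → eq s p

sumPaths-zero : ∀ n → sumPaths (λ _ → + 0) n ≡ + 0
sumPaths-zero zero    = refl
sumPaths-zero (suc n) = sumPaths-zero n

sumPaths-+ : ∀ n (g h : Path → ℤ) → sumPaths (λ p → g p + h p) n ≡ sumPaths g n + sumPaths h n
sumPaths-+ zero    g h = refl
sumPaths-+ (suc n) g h = begin
  sumPaths (λ p → sumSteps λ s → g (s ∷ p) + h (s ∷ p)) n
    ≡⟨ sumPaths-cong n (λ p → sumSteps-+ (λ s → g (s ∷ p)) (λ s → h (s ∷ p))) ⟩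
  sumPaths (λ p → (g ⁺) p + (h ⁺) p) n
    ≡⟨ sumPaths-+ n (g ⁺) (h ⁺) ⟩
  sumPaths (g ⁺) n + sumPaths (h ⁺) n ∎

sumPaths-*ˡ : ∀ n c (g : Path → ℤ) → sumPaths (λ p → c * g p) n ≡ c * sumPaths g n
sumPaths-*ˡ zero    c g = refl
sumPaths-*ˡ (suc n) c g =
  trans (sumPaths-cong n (λ p → sumSteps-*ˡ c (λ s → g (s ∷ p)))) (sumPaths-*ˡ n c (g ⁺))

sumPaths-rot : ∀ n (g : Path → ℤ) → sumPaths (λ p → g (map rot p)) n ≡ sumPaths g n
sumPaths-rot zero    g = refl
sumPaths-rot (suc n) g =
  trans (sumPaths-rot n (λ q → sumSteps λ s → g (rot s ∷ q)))
        (sumPaths-cong n (λ q → sumSteps-rot (λ s → g (s ∷ q))))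

sumList : ∀ {A : Set} → (A → ℤ) → List A → ℤ
sumList g []       = + 0
sumList g (x ∷ xs) = g x + sumList g xs

sumList-++ : ∀ {A : Set} (g : A → ℤ) xs ys → sumList g (xs ++ ys) ≡ sumList g xs + sumList g ys
sumList-++ g []       ys = sym (ℤ.+-identityˡ (sumList g ys))
sumList-++ g (x ∷ xs) ys =
  trans (cong (_+_ (g x)) (sumList-++ g xs ys)) (sym (ℤ.+-assoc (g x) (sumList g xs) (sumList g ys)))

sumList-concatMap : ∀ {A B : Set} (g : B → ℤ) (f : A → List B) xs →
                    sumList g (concatMap f xs) ≡ sumList (λ x → sumList g (f x)) xs
sumList-concatMap g f []       = refl
sumList-concatMap g f (x ∷ xs) =
  trans (sumList-++ g (f x) (concatMap f xs)) (cong (_+_ (sumList g (f x))) (sumList-concatMap g f xs))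

sumList-allPaths : ∀ n (g : Path → ℤ) → sumList g (allPaths n) ≡ sumPaths g n
sumList-allPaths zero    g = ℤ.+-identityʳ (g [])
sumList-allPaths (suc n) g = begin
  sumList g (concatMap (λ p → map (_∷ p) steps) (allPaths n))
    ≡⟨ sumList-concatMap g (λ p → map (_∷ p) steps) (allPaths n) ⟩
  sumList (λ p → sumList g (map (_∷ p) steps)) (allPaths n)
    ≡⟨ sumList-allPaths n _ ⟩
  sumPaths (λ p → sumList g (map (_∷ p) steps)) n
    ≡⟨ sumPaths-cong n (λ p → reassoc (g (U ∷ p)) (g (R ∷ p)) (g (D ∷ p)) (g (L ∷ p))) ⟩
  sumPaths (g ⁺) n ∎
  where
  reassoc : ∀ a b c d → a + (b + (c + (d + + 0))) ≡ a + b + c + d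
  reassoc = solve-∀

indicator : ∀ {P : Set} → Dec P → ℤ
indicator (yes _) = + 1
indicator (no _)  = + 0

length-filter : ∀ {A : Set} {P : Pred A _} (P? : Decidable P) xs →
                + length (filter P? xs) ≡ sumList (λ x → indicator (P? x)) xs
length-filter P? []       = refl
length-filter P? (x ∷ xs) with P? x
... | yes _ = cong (_+_ (+ 1)) (length-filter P? xs)
... | no _  = trans (length-filter P? xs) (sym (ℤ.+-identityˡ _))

rdegIndicator : ℕ → Path → ℤ
rdegIndicator r p = indicator (hasRdeg? r p)

countRdeg≡sumPaths : ∀ n r → + countRdeg n r ≡ sumPaths (rdegIndicator r) n
countRdeg≡sumPaths n r =
  trans (length-filter (hasRdeg? r) (allPaths n)) (sumList-allPaths n (rdegIndicator r))

mutual
  hTransfer : ℕ → (ℕ → ℤ) → ℤ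
  hTransfer zero    σ = + 2 * σ 1
  hTransfer (suc k) σ = + 2 * hTransfer k σ + vTransfer k (λ m → σ (suc m))

  vTransfer : ℕ → (ℕ → ℤ) → ℤ
  vTransfer zero    σ = + 4 * σ 0
  vTransfer (suc k) σ = + 2 * vTransfer k σ + hTransfer k σ

mutual
  hTransfer-cong : ∀ k {σ τ} → (∀ m → m ≤ suc k → σ m ≡ τ m) → hTransfer k σ ≡ hTransfer k τ
  hTransfer-cong zero    eq = cong (_*_ (+ 2)) (eq 1 ℕ.≤-refl)
  hTransfer-cong (suc k) eq = cong₂ (λ a b → + 2 * a + b)
    (hTransfer-cong k λ m m≤ → eq m (ℕ.m≤n⇒m≤1+n m≤))
    (vTransfer-cong k λ m m≤ → eq (suc m) (s≤s (ℕ.m≤n⇒m≤1+n m≤)))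

  vTransfer-cong : ∀ k {σ τ} → (∀ m → m ≤ k → σ m ≡ τ m) → vTransfer k σ ≡ vTransfer k τ
  vTransfer-cong zero    eq = cong (_*_ (+ 4)) (eq 0 z≤n)
  vTransfer-cong (suc k) eq = cong₂ (λ a b → + 2 * a + b)
    (vTransfer-cong k λ m m≤ → eq m (ℕ.m≤n⇒m≤1+n m≤))
    (hTransfer-cong k eq)

private
  double-+ : ∀ a b c d → + 2 * (a + b) + (c + d) ≡ (+ 2 * a + c) + (+ 2 * b + d)
  double-+ = solve-∀

  double-* : ∀ c a b → + 2 * (c * a) + c * b ≡ c * (+ 2 * a + b)
  double-* = solve-∀

mutual
  hTransfer-+ : ∀ k σ τ → hTransfer k (λ m → σ m + τ m) ≡ hTransfer k σ + hTransfer k τ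
  hTransfer-+ zero    σ τ = ℤ.*-distribˡ-+ (+ 2) (σ 1) (τ 1)
  hTransfer-+ (suc k) σ τ = trans
    (cong₂ (λ a b → + 2 * a + b) (hTransfer-+ k σ τ) (vTransfer-+ k _ _))
    (double-+ (hTransfer k σ) (hTransfer k τ) _ _)

  vTransfer-+ : ∀ k σ τ → vTransfer k (λ m → σ m + τ m) ≡ vTransfer k σ + vTransfer k τ
  vTransfer-+ zero    σ τ = ℤ.*-distribˡ-+ (+ 4) (σ 0) (τ 0)
  vTransfer-+ (suc k) σ τ = trans
    (cong₂ (λ a b → + 2 * a + b) (vTransfer-+ k σ τ) (hTransfer-+ k σ τ))
    (double-+ (vTransfer k σ) (vTransfer k τ) _ _)

mutual
  hTransfer-*ˡ : ∀ k c σ → hTransfer k (λ m → c * σ m) ≡ c * hTransfer k σ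
  hTransfer-*ˡ zero    c σ = x∙yz≈y∙xz (+ 2) c (σ 1)
  hTransfer-*ˡ (suc k) c σ = trans
    (cong₂ (λ a b → + 2 * a + b) (hTransfer-*ˡ k c σ) (vTransfer-*ˡ k c _))
    (double-* c (hTransfer k σ) _)

  vTransfer-*ˡ : ∀ k c σ → vTransfer k (λ m → c * σ m) ≡ c * vTransfer k σ
  vTransfer-*ˡ zero    c σ = x∙yz≈y∙xz (+ 4) c (σ 0)
  vTransfer-*ˡ (suc k) c σ = trans
    (cong₂ (λ a b → + 2 * a + b) (vTransfer-*ˡ k c σ) (hTransfer-*ˡ k c σ))
    (double-* c (vTransfer k σ) _)

vTransfer-zero : ∀ k {σ} → (∀ m → σ m ≡ + 0) → vTransfer k σ ≡ + 0
vTransfer-zero k {σ} σ≡0 = begin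
  vTransfer k σ                  ≡⟨ vTransfer-cong k (λ m _ → trans (σ≡0 m) (sym (ℤ.*-zeroˡ (σ m)))) ⟩
  vTransfer k (λ m → + 0 * σ m)  ≡⟨ vTransfer-*ˡ k (+ 0) σ ⟩
  + 0 * vTransfer k σ            ≡⟨ ℤ.*-zeroˡ (vTransfer k σ) ⟩
  + 0                            ∎

hTransfer-sumTo : ∀ k N (F : ℕ → ℕ → ℤ) →
                  hTransfer k (λ m → sumTo N (λ l → F l m)) ≡ sumTo N (λ l → hTransfer k (F l))
hTransfer-sumTo k zero    F = refl
hTransfer-sumTo k (suc N) F =
  trans (hTransfer-+ k _ (F (suc N))) (cong (_+ hTransfer k (F (suc N))) (hTransfer-sumTo k N F))

-- For nonempty q, hTail g q evaluates g on the reductions of R ∷ q and L ∷ q, and vTail g q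
-- on what remains of a reduction once its current segment has reached its vertical run.
hTail : (Path → ℤ) → Path → ℤ
hTail g q = g (skipH R (normEnd q)) + g (skipH L (normEnd q))

vTail : (Path → ℤ) → Path → ℤ
vTail g q = g (skipV (normEnd q))

hTail-⁺ : ∀ g s p → (hTail g ⁺) (s ∷ p) ≡ + 2 * hTail g (s ∷ p) + vTail (g ⁺) (s ∷ p)
hTail-⁺ g s p = regroup (g (skipH R w)) (g (skipH L w)) (g (U ∷ v)) (g (R ∷ v)) (g (D ∷ v)) (g (L ∷ v))
  where
  w = normEnd (s ∷ p)
  v = skipV w
  regroup : ∀ a b u r d l → r + u + (a + b) + (d + l) + (a + b) ≡ + 2 * (a + b) + (u + r + d + l)
  regroup = solve-∀

vTail-⁺ : ∀ g s p → (vTail g ⁺) (s ∷ p) ≡ + 2 * vTail g (s ∷ p) + hTail g (s ∷ p)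
vTail-⁺ g s p = regroup (g (skipV w)) (g (skipH R w)) (g (skipH L w))
  where
  w = normEnd (s ∷ p)
  regroup : ∀ a b c → a + b + a + c ≡ + 2 * a + (b + c)
  regroup = solve-∀

sumPaths-suc-suc : ∀ k (F G : Path → ℤ) → (∀ s p → (F ⁺) (s ∷ p) ≡ + 2 * F (s ∷ p) + G (s ∷ p)) →
                    sumPaths F (suc (suc k)) ≡ + 2 * sumPaths F (suc k) + sumPaths G (suc k)
sumPaths-suc-suc k F G eq = begin
  sumPaths (F ⁺) (suc k)                                   ≡⟨ sumPaths-cong⁺ k (F ⁺) (λ q → + 2 * F q + G q) eq ⟩
  sumPaths (λ q → + 2 * F q + G q) (suc k)                 ≡⟨ sumPaths-+ (suc k) (λ q → + 2 * F q) G ⟩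
  sumPaths (λ q → + 2 * F q) (suc k) + sumPaths G (suc k)  ≡⟨ cong (_+ sumPaths G (suc k)) (sumPaths-*ˡ (suc k) (+ 2) F) ⟩
  + 2 * sumPaths F (suc k) + sumPaths G (suc k)            ∎

mutual
  sumPaths-hTail : ∀ k g → sumPaths (hTail g) (suc k) ≡ hTransfer k (sumPaths g)
  sumPaths-hTail zero    g = regroup (g (U ∷ [])) (g (R ∷ [])) (g (D ∷ [])) (g (L ∷ []))
    where
    regroup : ∀ u r d l → r + u + (d + l) + (d + l) + (r + u) ≡ + 2 * (u + r + d + l)
    regroup = solve-∀
  sumPaths-hTail (suc k) g = trans (sumPaths-suc-suc k (hTail g) (vTail (g ⁺)) (hTail-⁺ g))
    (cong₂ (λ a b → + 2 * a + b) (sumPaths-hTail k g) (sumPaths-vTail k (g ⁺)))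

  sumPaths-vTail : ∀ k g → sumPaths (vTail g) (suc k) ≡ vTransfer k (sumPaths g)
  sumPaths-vTail zero    g = quadruple (g [])
    where
    quadruple : ∀ a → a + a + a + a ≡ + 4 * a
    quadruple = solve-∀
  sumPaths-vTail (suc k) g = trans (sumPaths-suc-suc k (vTail g) (hTail g) (vTail-⁺ g))
    (cong₂ (λ a b → + 2 * a + b) (sumPaths-vTail k g) (sumPaths-hTail k g))

countRdeg-degree-suc : ∀ k r → + countRdeg (suc (suc k)) (suc r) ≡ + 2 * hTransfer k (λ m → + countRdeg m r)
countRdeg-degree-suc k r = begin
  + countRdeg (suc (suc k)) (suc r)
    ≡⟨ countRdeg≡sumPaths (suc (suc k)) (suc r) ⟩
  sumPaths (rdegIndicator (suc r)) (suc (suc k))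
    ≡⟨ sumPaths-cong⁺ k (rdegIndicator (suc r) ⁺) (λ q → T q + T (map rot q)) firstStep ⟩
  sumPaths (λ q → T q + T (map rot q)) (suc k)
    ≡⟨ sumPaths-+ (suc k) T (λ q → T (map rot q)) ⟩
  sumPaths T (suc k) + sumPaths (λ q → T (map rot q)) (suc k)
    ≡⟨ cong (_+_ (sumPaths T (suc k))) (sumPaths-rot (suc k) T) ⟩
  sumPaths T (suc k) + sumPaths T (suc k)
    ≡⟨ twice (sumPaths T (suc k)) ⟩
  + 2 * sumPaths T (suc k)
    ≡⟨ cong (_*_ (+ 2)) (sumPaths-hTail k (rdegIndicator r)) ⟩
  + 2 * hTransfer k (sumPaths (rdegIndicator r))
    ≡⟨ cong (_*_ (+ 2)) (hTransfer-cong k (λ m _ → sym (countRdeg≡sumPaths m r))) ⟩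
  + 2 * hTransfer k (λ m → + countRdeg m r) ∎
  where
  T : Path → ℤ
  T = hTail (rdegIndicator r)
  twice : ∀ a → a + a ≡ + 2 * a
  twice = solve-∀
  -- A vertical first step is rotated away, so the first steps U, D contribute T of the rotated tail.
  firstStep : ∀ s p → (rdegIndicator (suc r) ⁺) (s ∷ p) ≡ T (s ∷ p) + T (map rot (s ∷ p))
  firstStep s p = regroup (rdegIndicator r (skipH R (normEnd (s ∷ p))))
                          (rdegIndicator r (skipH L (normEnd (s ∷ p))))
                          (rdegIndicator r (skipH R (normEnd (map rot (s ∷ p)))))
                          (rdegIndicator r (skipH L (normEnd (map rot (s ∷ p)))))
    where
    regroup : ∀ a b a′ b′ → a′ + a + b′ + b ≡ a + b + (a′ + b′)
    regroup = solve-∀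

binomDiff : ℕ → ℤ → ℤ
binomDiff M z = + binomℤ M z - + binomℤ M (z - + 1)

ballot : ℕ → ℕ → ℤ
ballot n i = binomDiff (2 ℕ.* n ℕ.∸ 1) (+ n - + i)

summand≡ballot : ∀ n r l → summand n r l ≡ + l * sgn l * ballot n (l ℕ.* 2 ^ r)
summand≡ballot n r l = refl

binomℤ-pascal : ∀ M z → + binomℤ (suc M) z ≡ + binomℤ M z + + binomℤ M (z - + 1)
binomℤ-pascal M (+ zero)  = refl
binomℤ-pascal M (+ suc k) =
  cong +_ (trans (sym (nCk+nC[k+1]≡[n+1]C[k+1] M k)) (ℕ.+-comm (M C k) (M C suc k)))
binomℤ-pascal M -[1+ k ]  = refl

binomDiff-suc-suc : ∀ M z →
  binomDiff (suc (suc M)) z ≡ binomDiff M z + + 2 * binomDiff M (z - + 1) + binomDiff M (z - + 1 - + 1)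
binomDiff-suc-suc M z = begin
  b₂ z - b₂ (z - + 1)
    ≡⟨ cong₂ _-_ (pascal² z) (pascal² (z - + 1)) ⟩
  (b z + b (z - + 1) + (b (z - + 1) + b (z - + 1 - + 1)))
    - (b (z - + 1) + b (z - + 1 - + 1) + (b (z - + 1 - + 1) + b (z - + 1 - + 1 - + 1)))
    ≡⟨ regroup (b z) (b (z - + 1)) (b (z - + 1 - + 1)) (b (z - + 1 - + 1 - + 1)) ⟩
  binomDiff M z + + 2 * binomDiff M (z - + 1) + binomDiff M (z - + 1 - + 1) ∎
  where
  b b₂ : ℤ → ℤ
  b  z = + binomℤ M z
  b₂ z = + binomℤ (suc (suc M)) z
  pascal² : ∀ z → b₂ z ≡ b z + b (z - + 1) + (b (z - + 1) + b (z - + 1 - + 1))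
  pascal² z = trans (binomℤ-pascal (suc M) z) (cong₂ _+_ (binomℤ-pascal M z) (binomℤ-pascal M (z - + 1)))
  regroup : ∀ a₀ a₁ a₂ a₃ → (a₀ + a₁ + (a₁ + a₂)) - (a₁ + a₂ + (a₂ + a₃)) ≡ (a₀ - a₁) + + 2 * (a₁ - a₂) + (a₂ - a₃)
  regroup = solve-∀

ballot-suc-suc : ∀ n i → ballot (suc n) (suc i) ≡ ballot n i + + 2 * ballot n (suc i) + ballot n (suc (suc i))
ballot-suc-suc zero    zero    = refl
ballot-suc-suc zero    (suc i) = refl
ballot-suc-suc (suc n) i = begin
  ballot (suc (suc n)) (suc i)
    ≡⟨ cong₂ binomDiff (cong suc (ℕ.+-suc n (suc (n ℕ.+ 0)))) (shift (+ suc n) (+ i)) ⟩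
  binomDiff (suc (suc M)) z
    ≡⟨ binomDiff-suc-suc M z ⟩
  binomDiff M z + + 2 * binomDiff M (z - + 1) + binomDiff M (z - + 1 - + 1)
    ≡⟨ sym (cong₂ (λ x y → binomDiff M z + + 2 * binomDiff M x + binomDiff M y)
                  (lower (+ suc n) (+ i)) (trans (lower (+ suc n) (+ suc i)) (cong (_- + 1) (lower (+ suc n) (+ i))))) ⟩
  ballot (suc n) i + + 2 * ballot (suc n) (suc i) + ballot (suc n) (suc (suc i)) ∎
  where
  M = 2 ℕ.* suc n ℕ.∸ 1
  z = + suc n - + i
  shift : ∀ x y → (+ 1 + x) - (+ 1 + y) ≡ x - y
  shift = solve-∀
  lower : ∀ x y → x - (+ 1 + y) ≡ x - y - + 1
  lower = solve-∀

+m-+n≡-[1+n∸1+m] : ∀ {m n} → m < n → + m - + n ≡ -[1+ n ℕ.∸ suc m ]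
+m-+n≡-[1+n∸1+m] {zero}  {suc n} _         = refl
+m-+n≡-[1+n∸1+m] {suc m} {suc n} (s≤s m<n) =
  trans (trans (ℤ.m-n≡m⊖n (suc m) (suc n)) (ℤ.[1+m]⊖[1+n]≡m⊖n m n))
        (trans (sym (ℤ.m-n≡m⊖n m n)) (+m-+n≡-[1+n∸1+m] m<n))

ballot-vanish : ∀ n i → n < i → ballot n i ≡ + 0
ballot-vanish n i n<i rewrite +m-+n≡-[1+n∸1+m] n<i = refl

ballot-suc-zero : ∀ n → ballot (suc n) 0 ≡ + 0
ballot-suc-zero n = begin
  ballot (suc n) 0
    ≡⟨ cong (λ m → binomDiff (n ℕ.+ suc m) (+ suc m)) (ℕ.+-identityʳ n) ⟩
  + ((n ℕ.+ suc n) C suc n) - + ((n ℕ.+ suc n) C n)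
    ≡⟨ cong (λ c → + c - + ((n ℕ.+ suc n) C n)) symmetry ⟩
  + ((n ℕ.+ suc n) C n) - + ((n ℕ.+ suc n) C n)
    ≡⟨ ℤ.+-inverseʳ (+ ((n ℕ.+ suc n) C n)) ⟩
  + 0 ∎
  where
  symmetry : (n ℕ.+ suc n) C suc n ≡ (n ℕ.+ suc n) C n
  symmetry = trans (nCk≡nC[n∸k] (ℕ.m≤n+m (suc n) n)) (cong ((n ℕ.+ suc n) C_) (ℕ.m+n∸n≡m n (suc n)))

hTransfer-ballot-zero : ∀ k → hTransfer k (λ m → ballot m 0) ≡ + 0
hTransfer-ballot-zero zero    = refl
hTransfer-ballot-zero (suc k) =
  cong₂ (λ a b → + 2 * a + b) (hTransfer-ballot-zero k) (vTransfer-zero k ballot-suc-zero)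

hTransfer-ballot-suc : ∀ k j →
  hTransfer k (λ m → ballot (suc m) (suc j)) ≡
  hTransfer k (λ m → ballot m j) + + 2 * hTransfer k (λ m → ballot m (suc j)) + hTransfer k (λ m → ballot m (suc (suc j)))
hTransfer-ballot-suc k j = begin
  hTransfer k (λ m → ballot (suc m) (suc j))
    ≡⟨ hTransfer-cong k (λ m _ → ballot-suc-suc m j) ⟩
  hTransfer k (λ m → ballot m j + + 2 * ballot m (suc j) + ballot m (suc (suc j)))
    ≡⟨ hTransfer-+ k _ (λ m → ballot m (suc (suc j))) ⟩
  hTransfer k (λ m → ballot m j + + 2 * ballot m (suc j)) + hTransfer k (λ m → ballot m (suc (suc j)))
    ≡⟨ cong (_+ hTransfer k (λ m → ballot m (suc (suc j))))
            (trans (hTransfer-+ k _ _) (cong (_+_ (hTransfer k (λ m → ballot m j))) (hTransfer-*ˡ k (+ 2) _))) ⟩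
  hTransfer k (λ m → ballot m j) + + 2 * hTransfer k (λ m → ballot m (suc j)) + hTransfer k (λ m → ballot m (suc (suc j))) ∎

double-suc : ∀ j → suc j ℕ.+ suc j ≡ suc (suc (j ℕ.+ j))
double-suc j = cong suc (ℕ.+-suc j j)

mutual
  hTransfer-ballot : ∀ k j → hTransfer k (λ m → ballot m j) ≡ + 2 * ballot (suc (suc k)) (j ℕ.+ j)
  hTransfer-ballot k zero = trans (hTransfer-ballot-zero k) (sym (cong (_*_ (+ 2)) (ballot-suc-zero (suc k))))
  hTransfer-ballot zero (suc zero) = refl
  hTransfer-ballot zero (suc (suc j)) = trans
    (cong (_*_ (+ 2)) (ballot-vanish 1 (suc (suc j)) (s≤s (s≤s z≤n))))
    (sym (cong (_*_ (+ 2)) (ballot-vanish 2 _ (s≤s (s≤s (ℕ.≤-trans (s≤s z≤n) (ℕ.m≤n+m (suc (suc j)) j)))))))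
  hTransfer-ballot (suc k) (suc j) = begin
    + 2 * hTransfer k (λ m → ballot m (suc j)) + vTransfer k (λ m → ballot (suc m) (suc j))
      ≡⟨ cong₂ (λ a b → + 2 * a + b) (hTransfer-ballot k (suc j)) (vTransfer-ballot k j) ⟩
    + 2 * (+ 2 * B (suc j ℕ.+ suc j)) + + 2 * (B (suc i) + B (suc (suc (suc i))))
      ≡⟨ cong (λ x → + 2 * (+ 2 * B x) + + 2 * (B (suc i) + B (suc (suc (suc i))))) (double-suc j) ⟩
    + 2 * (+ 2 * B (suc (suc i))) + + 2 * (B (suc i) + B (suc (suc (suc i))))
      ≡⟨ regroup (B (suc i)) (B (suc (suc i))) (B (suc (suc (suc i)))) ⟩
    + 2 * (B (suc i) + + 2 * B (suc (suc i)) + B (suc (suc (suc i))))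
      ≡⟨ cong (_*_ (+ 2)) (sym (ballot-suc-suc (suc (suc k)) (suc i))) ⟩
    + 2 * ballot (suc (suc (suc k))) (suc (suc i))
      ≡⟨ cong (λ x → + 2 * ballot (suc (suc (suc k))) x) (sym (double-suc j)) ⟩
    + 2 * ballot (suc (suc (suc k))) (suc j ℕ.+ suc j) ∎
    where
    B : ℕ → ℤ
    B = ballot (suc (suc k))
    i = j ℕ.+ j
    regroup : ∀ a b c → + 2 * (+ 2 * b) + + 2 * (a + c) ≡ + 2 * (a + + 2 * b + c)
    regroup = solve-∀

  vTransfer-ballot : ∀ k j → vTransfer k (λ m → ballot (suc m) (suc j)) ≡
                     + 2 * (ballot (suc (suc k)) (suc (j ℕ.+ j)) + ballot (suc (suc k)) (suc (suc (suc (j ℕ.+ j)))))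
  vTransfer-ballot zero zero = refl
  vTransfer-ballot zero (suc j) = trans
    (cong (_*_ (+ 4)) (ballot-vanish 1 (suc (suc j)) (s≤s (s≤s z≤n))))
    (sym (cong₂ (λ a b → + 2 * (a + b))
                (ballot-vanish 2 _ (s≤s (s≤s (ℕ.≤-trans (s≤s z≤n) (ℕ.m≤n+m (suc j) j)))))
                (ballot-vanish 2 (suc (suc (suc (suc (j ℕ.+ suc j))))) (s≤s (s≤s (s≤s z≤n))))))
  vTransfer-ballot (suc k) j = begin
    + 2 * vTransfer k (λ m → ballot (suc m) (suc j)) + hTransfer k (λ m → ballot (suc m) (suc j))
      ≡⟨ cong₂ (λ a b → + 2 * a + b) (vTransfer-ballot k j) (hTransfer-ballot-suc k j) ⟩
    + 2 * (+ 2 * (B (suc i) + B (suc (suc (suc i)))))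
      + (hTransfer k (λ m → ballot m j) + + 2 * hTransfer k (λ m → ballot m (suc j)) + hTransfer k (λ m → ballot m (suc (suc j))))
      ≡⟨ cong₃ (λ x y z → + 2 * (+ 2 * (B (suc i) + B (suc (suc (suc i))))) + (x + + 2 * y + z))
               (hTransfer-ballot k j)
               (trans (hTransfer-ballot k (suc j)) (cong (λ x → + 2 * B x) (double-suc j)))
               (trans (hTransfer-ballot k (suc (suc j)))
                      (cong (λ x → + 2 * B x) (trans (double-suc (suc j)) (cong (λ x → suc (suc x)) (double-suc j))))) ⟩
    + 2 * (+ 2 * (B (suc i) + B (suc (suc (suc i)))))
      + (+ 2 * B i + + 2 * (+ 2 * B (suc (suc i))) + + 2 * B (suc (suc (suc (suc i)))))
      ≡⟨ regroup (B i) (B (suc i)) (B (suc (suc i))) (B (suc (suc (suc i)))) (B (suc (suc (suc (suc i))))) ⟩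
    + 2 * ((B i + + 2 * B (suc i) + B (suc (suc i))) + (B (suc (suc i)) + + 2 * B (suc (suc (suc i))) + B (suc (suc (suc (suc i))))))
      ≡⟨ sym (cong₂ (λ x y → + 2 * (x + y)) (ballot-suc-suc (suc (suc k)) i) (ballot-suc-suc (suc (suc k)) (suc (suc i)))) ⟩
    + 2 * (ballot (suc (suc (suc k))) (suc i) + ballot (suc (suc (suc k))) (suc (suc (suc i)))) ∎
    where
    B : ℕ → ℤ
    B = ballot (suc (suc k))
    i = j ℕ.+ j
    cong₃ : ∀ {A : Set} (f : A → A → A → ℤ) {x x′ y y′ z z′} → x ≡ x′ → y ≡ y′ → z ≡ z′ → f x y z ≡ f x′ y′ z′
    cong₃ f refl refl refl = refl
    regroup : ∀ b₀ b₁ b₂ b₃ b₄ →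
      + 2 * (+ 2 * (b₁ + b₃)) + (+ 2 * b₀ + + 2 * (+ 2 * b₂) + + 2 * b₄) ≡
      + 2 * ((b₀ + + 2 * b₁ + b₂) + (b₂ + + 2 * b₃ + b₄))
    regroup = solve-∀

sumTo-cong : ∀ N {f g : ℕ → ℤ} → (∀ l → f l ≡ g l) → sumTo N f ≡ sumTo N g
sumTo-cong zero    eq = eq 0
sumTo-cong (suc N) eq = cong₂ _+_ (sumTo-cong N eq) (eq (suc N))

sumTo-zero : ∀ N {f : ℕ → ℤ} → (∀ l → f l ≡ + 0) → sumTo N f ≡ + 0
sumTo-zero zero    eq = eq 0
sumTo-zero (suc N) eq = cong₂ _+_ (sumTo-zero N eq) (eq (suc N))

sumTo-*ˡ : ∀ N c (f : ℕ → ℤ) → sumTo N (λ l → c * f l) ≡ c * sumTo N f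
sumTo-*ˡ zero    c f = refl
sumTo-*ˡ (suc N) c f =
  trans (cong (_+ c * f (suc N)) (sumTo-*ˡ N c f)) (sym (ℤ.*-distribˡ-+ c (sumTo N f) (f (suc N))))

ballot-alternating-telescope : ∀ n N →
  sumTo N (λ l → + l * sgn l * ballot (suc n) l) ≡
  ballot n 0 - sgn (suc N) * (+ suc N * ballot n N + + N * ballot n (suc N))
ballot-alternating-telescope n zero = base (ballot n 0) (ballot n 1)
  where
  base : ∀ a b → + 0 ≡ a - + 1 * (+ 1 * a + + 0 * b)
  base = solve-∀
ballot-alternating-telescope n (suc N) = begin
  sumTo N (λ l → + l * sgn l * ballot (suc n) l) + + suc N * sgn (suc N) * ballot (suc n) (suc N)
    ≡⟨ cong₂ _+_ (ballot-alternating-telescope n N) (cong (_*_ (+ suc N * sgn (suc N))) (ballot-suc-suc n N)) ⟩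
  ballot n 0 - sgn (suc N) * (+ suc N * ballot n N + + N * ballot n (suc N))
    + + suc N * sgn (suc N) * (ballot n N + + 2 * ballot n (suc N) + ballot n (suc (suc N)))
    ≡⟨ step (ballot n 0) (ballot n N) (ballot n (suc N)) (ballot n (suc (suc N))) (sgn (suc N)) (+ N) ⟩
  ballot n 0 - sgn (suc (suc N)) * (+ suc (suc N) * ballot n (suc N) + + suc N * ballot n (suc (suc N))) ∎
  where
  step : ∀ d₀ a b c e x →
    d₀ - e * ((+ 1 + x) * a + x * b) + (+ 1 + x) * e * (a + + 2 * b + c) ≡
    d₀ - (- + 1 * e) * ((+ 1 + (+ 1 + x)) * b + (+ 1 + x) * c)
  step = solve-∀

ballot-alternating-sum : ∀ {n N} → n < N → sumTo N (λ l → + l * sgn l * ballot (suc n) l) ≡ ballot n 0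
ballot-alternating-sum {n} {N} n<N = begin
  sumTo N (λ l → + l * sgn l * ballot (suc n) l)
    ≡⟨ ballot-alternating-telescope n N ⟩
  ballot n 0 - sgn (suc N) * (+ suc N * ballot n N + + N * ballot n (suc N))
    ≡⟨ cong₂ (λ a b → ballot n 0 - sgn (suc N) * (+ suc N * a + + N * b))
             (ballot-vanish n N n<N) (ballot-vanish n (suc N) (ℕ.m≤n⇒m≤1+n n<N)) ⟩
  ballot n 0 - sgn (suc N) * (+ suc N * + 0 + + N * + 0)
    ≡⟨ boundary (ballot n 0) (sgn (suc N)) (+ suc N) (+ N) ⟩
  ballot n 0 ∎
  where
  boundary : ∀ d e x y → d - e * (x * + 0 + y * + 0) ≡ d
  boundary = solve-∀

summand-vanish : ∀ m r → m < 2 ^ r → ∀ l → summand m r l ≡ + 0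
summand-vanish m r m<2^r zero    = refl
summand-vanish m r m<2^r (suc l) = trans
  (cong (_*_ (+ suc l * sgn (suc l))) (ballot-vanish m _ (ℕ.≤-trans m<2^r (ℕ.m≤m+n (2 ^ r) (l ℕ.* 2 ^ r)))))
  (ℤ.*-zeroʳ (+ suc l * sgn (suc l)))

hTransfer-summand : ∀ k r l → hTransfer k (λ m → summand m r l) ≡ + 2 * summand (suc (suc k)) (suc r) l
hTransfer-summand k r l = begin
  hTransfer k (λ m → summand m r l)
    ≡⟨ hTransfer-cong k (λ m _ → summand≡ballot m r l) ⟩
  hTransfer k (λ m → c * ballot m i)
    ≡⟨ hTransfer-*ˡ k c (λ m → ballot m i) ⟩
  c * hTransfer k (λ m → ballot m i)
    ≡⟨ cong (_*_ c) (hTransfer-ballot k i) ⟩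
  c * (+ 2 * ballot (suc (suc k)) (i ℕ.+ i))
    ≡⟨ cong (λ x → c * (+ 2 * ballot (suc (suc k)) x)) double ⟩
  c * (+ 2 * ballot (suc (suc k)) (l ℕ.* 2 ^ suc r))
    ≡⟨ x∙yz≈y∙xz c (+ 2) _ ⟩
  + 2 * (c * ballot (suc (suc k)) (l ℕ.* 2 ^ suc r))
    ≡⟨ cong (_*_ (+ 2)) (summand≡ballot (suc (suc k)) (suc r) l) ⟨
  + 2 * summand (suc (suc k)) (suc r) l ∎
  where
  c = + l * sgn l
  i = l ℕ.* 2 ^ r
  double : i ℕ.+ i ≡ l ℕ.* 2 ^ suc r
  double = trans (sym (ℕ.*-distribˡ-+ l (2 ^ r) (2 ^ r)))
                 (cong (λ x → l ℕ.* (2 ^ r ℕ.+ x)) (sym (ℕ.+-identityʳ (2 ^ r))))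

summand-rdeg-zero : ∀ n l → summand n 0 l ≡ + l * sgn l * ballot n l
summand-rdeg-zero n l = trans (summand≡ballot n 0 l) (cong (λ i → + l * sgn l * ballot n i) (ℕ.*-identityʳ l))

formula-rhs-vanish : ∀ N m r → m < 2 ^ r → + (4 ^ suc r) * sumTo N (summand m r) ≡ + 0
formula-rhs-vanish N m r m<2^r =
  trans (cong (_*_ (+ (4 ^ suc r))) (sumTo-zero N (summand-vanish m r m<2^r))) (ℤ.*-zeroʳ (+ (4 ^ suc r)))

countRdeg-degree-zero : ∀ n → + countRdeg (suc n) 0 ≡ + 4 * ballot n 0
countRdeg-degree-zero zero    = refl
-- Paths of length ≥ 2 are not single steps, so their indicator reduces to + 0.
countRdeg-degree-zero (suc k) = begin
  + countRdeg (suc (suc k)) 0                ≡⟨ countRdeg≡sumPaths (suc (suc k)) 0 ⟩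
  sumPaths (rdegIndicator 0) (suc (suc k))   ≡⟨ sumPaths-zero k ⟩
  + 0                                        ≡⟨ cong (_*_ (+ 4)) (ballot-suc-zero k) ⟨
  + 4 * ballot (suc k) 0                     ∎

countRdeg-formula : ∀ r N m → m ≤ N → + countRdeg m r ≡ + (4 ^ suc r) * sumTo N (summand m r)
countRdeg-formula zero N zero _ = sym (formula-rhs-vanish N 0 0 (s≤s z≤n))
countRdeg-formula zero N (suc n) n<N = begin
  + countRdeg (suc n) 0
    ≡⟨ countRdeg-degree-zero n ⟩
  + 4 * ballot n 0
    ≡⟨ cong (_*_ (+ 4)) (sym (ballot-alternating-sum n<N)) ⟩
  + 4 * sumTo N (λ l → + l * sgn l * ballot (suc n) l)
    ≡⟨ cong (_*_ (+ 4)) (sumTo-cong N (λ l → sym (summand-rdeg-zero (suc n) l))) ⟩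
  + 4 * sumTo N (summand (suc n) 0) ∎
countRdeg-formula (suc r) N zero _ = sym (formula-rhs-vanish N 0 (suc r) (ℕ.m^n>0 2 (suc r)))
countRdeg-formula (suc r) N (suc zero) _ = sym (formula-rhs-vanish N 1 (suc r) (ℕ.*-monoʳ-≤ 2 (ℕ.m^n>0 2 r)))
countRdeg-formula (suc r) N (suc (suc k)) k+2≤N = begin
  + countRdeg (suc (suc k)) (suc r)
    ≡⟨ countRdeg-degree-suc k r ⟩
  + 2 * hTransfer k (λ m → + countRdeg m r)
    ≡⟨ cong (_*_ (+ 2)) (hTransfer-cong k λ m m≤k+1 →
         countRdeg-formula r N m (ℕ.≤-trans m≤k+1 (ℕ.≤-trans (ℕ.n≤1+n (suc k)) k+2≤N))) ⟩
  + 2 * hTransfer k (λ m → c * sumTo N (summand m r))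
    ≡⟨ cong (_*_ (+ 2)) (trans (hTransfer-*ˡ k c _) (cong (_*_ c) (hTransfer-sumTo k N (λ l m → summand m r l)))) ⟩
  + 2 * (c * sumTo N (λ l → hTransfer k (λ m → summand m r l)))
    ≡⟨ cong (λ x → + 2 * (c * x)) (trans (sumTo-cong N (hTransfer-summand k r)) (sumTo-*ˡ N (+ 2) _)) ⟩
  + 2 * (c * (+ 2 * S))
    ≡⟨ regroup c S ⟩
  + 4 * c * S
    ≡⟨ cong (_* S) (sym (ℤ.pos-* 4 (4 ^ suc r))) ⟩
  + (4 ^ suc (suc r)) * S ∎
  where
  c = + (4 ^ suc r)
  S = sumTo N (summand (suc (suc k)) (suc r))
  regroup : ∀ c s → + 2 * (c * (+ 2 * s)) ≡ + 4 * c * s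
  regroup = solve-∀

proposition3p3 : (n r : ℕ) → 1 ≤ n → (N : ℕ) → n ≤ N →
    + countRdeg n r ≡ + (4 ^ suc r) * sumTo N (summand n r)
proposition3p3 n r _ N n≤N = countRdeg-formula r N n n≤N
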